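{- Let $G$ be a finite, simple, connected graph and let $f: V(G_1) \to V(G_2)$ be any function, where $G_1, G_2$ are disjoint copies of $G$. Then $\gamma(G) \le \gamma(C(G,f)) \le 2\gamma(G)$.
   Context: For disjoint copies $G_1,G_2$ of a graph $G$ and a function $f:V(G_1)\to V(G_2)$, the functigraph $C(G,f)$ has vertex set $V(G_1)\cup V(G_2)$ and edge set $E(G_1)\cup E(G_2)\cup\{uv : u\in V(G_1), v\in V(G_2), v=f(u)\}$. $\gamma(H)$ denotes the domination number of a graph $H$ (minimum size of a set $D$ such that every vertex outside $D$ has a neighbor in $D$). -}

module Defs where

open import Data.Nat using (ℕ; _≤_; _+_)
open import Data.Bool using (Bool; true; false)
open import Data.Fin using (Fin)
open import Data.Fin.Subset using (Subset; _∈_; _∉_; ∣_∣)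
open import Data.Product using (Σ; ∃; _×_; _,_)
open import Data.Sum using (_⊎_; inj₁; inj₂)
open import Data.Empty using (⊥)
open import Data.List using (List; []; _∷_)
open import Relation.Binary.PropositionalEquality using (_≡_)
open import Relation.Nullary using (¬_)

record Graph (n : ℕ) : Set where
  field
    adj   : Fin n → Fin n → Bool
    sym   : ∀ u v → adj u v ≡ adj v u
    irrefl : ∀ u → adj u u ≡ false
open Graph public

Adj : ∀ {n} → Graph n → Fin n → Fin n → Set
Adj G u v = adj G u v ≡ true

data Walk {n : ℕ} (G : Graph n) : Fin n → Fin n → Set where
  here : ∀ {u} → Walk G u u
  step : ∀ {u w v} → Adj G u w → Walk G w v → Walk G u v

Connected : ∀ {n} → Graph n → Set
Connected G = ∀ u v → Walk G u v

Dominating : ∀ {n} → Graph n → Subset n → Set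
Dominating {n} G D = ∀ v → v ∉ D → Σ (Fin n) λ u → u ∈ D × Adj G v u

IsDominationNumber : ∀ {n} → Graph n → ℕ → Set
IsDominationNumber G k =
  (Σ _ λ D → Dominating G D × ∣ D ∣ ≡ k) × (∀ D → Dominating G D → k ≤ ∣ D ∣)

-- Vertices of the functigraph: Fin (n + n); first copy is G₁ (indices < n),
-- second copy G₂ (indices ≥ n). We use Data.Fin.splitAt / join.
open import Data.Fin using (splitAt; _↑ˡ_; _↑ʳ_)
open import Data.Fin.Properties using (_≟_)
open import Relation.Nullary.Decidable using (⌊_⌋)

functigraphAdj : ∀ {n} → Graph n → (Fin n → Fin n) → Fin (n + n) → Fin (n + n) → Bool
functigraphAdj {n} G f x y with splitAt n x | splitAt n y
... | inj₁ u | inj₁ v = adj G u v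
... | inj₂ u | inj₂ v = adj G u v
... | inj₁ u | inj₂ v = ⌊ f u ≟ v ⌋
... | inj₂ u | inj₁ v = ⌊ f v ≟ u ⌋

functigraph : ∀ {n} → Graph n → (Fin n → Fin n) → Graph (n + n)
functigraph {n} G f = record
  { adj = functigraphAdj G f
  ; sym = symP
  ; irrefl = irr
  }
  where
  symP : ∀ x y → functigraphAdj G f x y ≡ functigraphAdj G f y x
  symP x y with splitAt n x | splitAt n y
  ... | inj₁ u | inj₁ v = Graph.sym G u v
  ... | inj₂ u | inj₂ v = Graph.sym G u v
  ... | inj₁ u | inj₂ v = Relation.Binary.PropositionalEquality.refl
  ... | inj₂ u | inj₁ v = Relation.Binary.PropositionalEquality.refl
  irr : ∀ x → functigraphAdj G f x x ≡ false
  irr x with splitAt n x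
  ... | inj₁ u = Graph.irrefl G u
  ... | inj₂ u = Graph.irrefl G u

-- A dominating set D of G, placed in both copies, dominates C(G,f); hence
-- γ(C(G,f)) ≤ 2γ(G).  Conversely, if D₁ ∪ D₂ dominates C(G,f) with Dᵢ ⊆ V(Gᵢ),
-- then f(D₁) ∪ D₂ dominates G: a vertex of G₂ outside D₂ is dominated either
-- inside G₂ or by some u ∈ D₁ with f u equal to it.  Hence γ(G) ≤ γ(C(G,f)).
module Submission where

open import Defs hiding (sym)
open import Data.Nat using (ℕ; _≤_; _*_; _+_; suc; z≤n; s≤s)
open import Data.Nat.Properties using (≤-trans; ≤-reflexive; +-monoˡ-≤; +-monoʳ-≤; +-suc; n≤1+n; +-identityʳ; module ≤-Reasoning)
open import Data.Bool.Properties using (T-≡)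
open import Data.Fin using (Fin; zero; suc; splitAt; _↑ˡ_; _↑ʳ_)
open import Data.Fin.Properties using (splitAt-↑ˡ; splitAt-↑ʳ; splitAt⁻¹-↑ˡ; splitAt⁻¹-↑ʳ)
open import Data.Fin.Subset using (Subset; _∈_; ∣_∣; _∪_; ⁅_⁆; ⊥; inside; outside)
open import Data.Fin.Subset.Properties using (x∈p∪q⁺; x∈⁅x⁆; ∣⁅x⁆∣≡1; ∣⊥∣≡0)
open import Data.Vec using ([]; _∷_; _++_; there)
open import Data.Vec.Properties using (lookup-++ˡ; lookup-++ʳ; []=⇒lookup; lookup⇒[]=)
import Data.Vec as Vec
open import Data.Product using (_×_; _,_)
open import Data.Sum using (inj₁; inj₂)
open import Data.Empty using (⊥-elim)
open import Function using (_∘_; Equivalence)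
open import Relation.Binary.PropositionalEquality using (_≡_; refl; sym; trans; cong; subst)
open import Relation.Nullary.Decidable using (toWitness)

private
  variable
    m n : ℕ

∈-++⁺ˡ : {p : Subset m} {q : Subset n} {i : Fin m} → i ∈ p → (i ↑ˡ n) ∈ (p ++ q)
∈-++⁺ˡ {p = p} {q} {i} i∈p = lookup⇒[]= _ (p ++ q) (trans (lookup-++ˡ p q i) ([]=⇒lookup i∈p))

∈-++⁺ʳ : {p : Subset m} {q : Subset n} {i : Fin n} → i ∈ q → (m ↑ʳ i) ∈ (p ++ q)
∈-++⁺ʳ {p = p} {q} {i} i∈q = lookup⇒[]= _ (p ++ q) (trans (lookup-++ʳ p q i) ([]=⇒lookup i∈q))

∈-++⁻ˡ : {p : Subset m} {q : Subset n} {i : Fin m} → (i ↑ˡ n) ∈ (p ++ q) → i ∈ p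
∈-++⁻ˡ {p = p} {q} {i} h = lookup⇒[]= i p (trans (sym (lookup-++ˡ p q i)) ([]=⇒lookup h))

∈-++⁻ʳ : {p : Subset m} {q : Subset n} {i : Fin n} → (m ↑ʳ i) ∈ (p ++ q) → i ∈ q
∈-++⁻ʳ {p = p} {q} {i} h = lookup⇒[]= i q (trans (sym (lookup-++ʳ p q i)) ([]=⇒lookup h))

∣p++q∣≡∣p∣+∣q∣ : (p : Subset m) (q : Subset n) → ∣ p ++ q ∣ ≡ ∣ p ∣ + ∣ q ∣
∣p++q∣≡∣p∣+∣q∣ []            q = refl
∣p++q∣≡∣p∣+∣q∣ (inside  ∷ p) q = cong suc (∣p++q∣≡∣p∣+∣q∣ p q)
∣p++q∣≡∣p∣+∣q∣ (outside ∷ p) q = ∣p++q∣≡∣p∣+∣q∣ p q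

∣p∪q∣≤∣p∣+∣q∣ : (p q : Subset n) → ∣ p ∪ q ∣ ≤ ∣ p ∣ + ∣ q ∣
∣p∪q∣≤∣p∣+∣q∣ []            []            = z≤n
∣p∪q∣≤∣p∣+∣q∣ (inside  ∷ p) (inside  ∷ q) =
  s≤s (≤-trans (∣p∪q∣≤∣p∣+∣q∣ p q) (+-monoʳ-≤ ∣ p ∣ (n≤1+n ∣ q ∣)))
∣p∪q∣≤∣p∣+∣q∣ (inside  ∷ p) (outside ∷ q) = s≤s (∣p∪q∣≤∣p∣+∣q∣ p q)
∣p∪q∣≤∣p∣+∣q∣ (outside ∷ p) (inside  ∷ q) =
  ≤-trans (s≤s (∣p∪q∣≤∣p∣+∣q∣ p q)) (≤-reflexive (sym (+-suc ∣ p ∣ ∣ q ∣)))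
∣p∪q∣≤∣p∣+∣q∣ (outside ∷ p) (outside ∷ q) = ∣p∪q∣≤∣p∣+∣q∣ p q

image : (Fin m → Fin n) → Subset m → Subset n
image f []            = ⊥
image f (outside ∷ p) = image (f ∘ suc) p
image f (inside  ∷ p) = ⁅ f zero ⁆ ∪ image (f ∘ suc) p

∈-image⁺ : (f : Fin m → Fin n) {p : Subset m} {i : Fin m} → i ∈ p → f i ∈ image f p
∈-image⁺ f {inside  ∷ p} {zero}  _           = x∈p∪q⁺ (inj₁ (x∈⁅x⁆ (f zero)))
∈-image⁺ f {inside  ∷ p} {suc i} (there i∈p) = x∈p∪q⁺ (inj₂ (∈-image⁺ (f ∘ suc) i∈p))
∈-image⁺ f {outside ∷ p} {suc i} (there i∈p) = ∈-image⁺ (f ∘ suc) i∈p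

∣image∣≤∣p∣ : (f : Fin m → Fin n) (p : Subset m) → ∣ image f p ∣ ≤ ∣ p ∣
∣image∣≤∣p∣ {n = n} f []   = ≤-reflexive (∣⊥∣≡0 n)
∣image∣≤∣p∣ f (outside ∷ p) = ∣image∣≤∣p∣ (f ∘ suc) p
∣image∣≤∣p∣ f (inside  ∷ p) = begin
  ∣ ⁅ f zero ⁆ ∪ image (f ∘ suc) p ∣      ≤⟨ ∣p∪q∣≤∣p∣+∣q∣ ⁅ f zero ⁆ (image (f ∘ suc) p) ⟩
  ∣ ⁅ f zero ⁆ ∣ + ∣ image (f ∘ suc) p ∣ ≡⟨ cong (_+ ∣ image (f ∘ suc) p ∣) (∣⁅x⁆∣≡1 (f zero)) ⟩
  suc ∣ image (f ∘ suc) p ∣              ≤⟨ s≤s (∣image∣≤∣p∣ (f ∘ suc) p) ⟩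
  suc ∣ p ∣                              ∎
  where open ≤-Reasoning

∣image∪q∣≤∣p++q∣ : (f : Fin m → Fin n) (p : Subset m) (q : Subset n) → ∣ image f p ∪ q ∣ ≤ ∣ p ++ q ∣
∣image∪q∣≤∣p++q∣ f p q = begin
  ∣ image f p ∪ q ∣     ≤⟨ ∣p∪q∣≤∣p∣+∣q∣ (image f p) q ⟩
  ∣ image f p ∣ + ∣ q ∣ ≤⟨ +-monoˡ-≤ ∣ q ∣ (∣image∣≤∣p∣ f p) ⟩
  ∣ p ∣ + ∣ q ∣         ≡⟨ ∣p++q∣≡∣p∣+∣q∣ p q ⟨
  ∣ p ++ q ∣            ∎
  where open ≤-Reasoning

data SplitView (m n : ℕ) : Fin (m + n) → Set where
  ↑ˡ-view : (i : Fin m) → SplitView m n (i ↑ˡ n)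
  ↑ʳ-view : (j : Fin n) → SplitView m n (m ↑ʳ j)

splitView : ∀ m n (x : Fin (m + n)) → SplitView m n x
splitView m n x with splitAt m x in eq
... | inj₁ i = subst (SplitView m n) (splitAt⁻¹-↑ˡ eq) (↑ˡ-view i)
... | inj₂ j = subst (SplitView m n) (splitAt⁻¹-↑ʳ eq) (↑ʳ-view j)

module Functigraph (G : Graph n) (f : Fin n → Fin n) where

  C : Graph (n + n)
  C = functigraph G f

  adj-↑ˡ : {u v : Fin n} → Adj G u v → Adj C (u ↑ˡ n) (v ↑ˡ n)
  adj-↑ˡ {u} {v} a rewrite splitAt-↑ˡ n u n | splitAt-↑ˡ n v n = a

  adj-↑ʳ : {u v : Fin n} → Adj G u v → Adj C (n ↑ʳ u) (n ↑ʳ v)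
  adj-↑ʳ {u} {v} a rewrite splitAt-↑ʳ n n u | splitAt-↑ʳ n n v = a

  adj-↑ʳ⁻ : {u v : Fin n} → Adj C (n ↑ʳ u) (n ↑ʳ v) → Adj G u v
  adj-↑ʳ⁻ {u} {v} a rewrite splitAt-↑ʳ n n u | splitAt-↑ʳ n n v = a

  adj-↑ʳ-↑ˡ⁻ : {v u : Fin n} → Adj C (n ↑ʳ v) (u ↑ˡ n) → f u ≡ v
  adj-↑ʳ-↑ˡ⁻ {v} {u} a rewrite splitAt-↑ʳ n n v | splitAt-↑ˡ n u n =
    toWitness (Equivalence.from T-≡ a)

  ++-dominating : {D₁ D₂ : Subset n} → Dominating G D₁ → Dominating G D₂ → Dominating C (D₁ ++ D₂)
  ++-dominating dom₁ dom₂ x x∉ with splitView n n x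
  ... | ↑ˡ-view u = let w , w∈ , a = dom₁ u (x∉ ∘ ∈-++⁺ˡ) in w ↑ˡ n , ∈-++⁺ˡ w∈ , adj-↑ˡ a
  ... | ↑ʳ-view u = let w , w∈ , a = dom₂ u (x∉ ∘ ∈-++⁺ʳ) in n ↑ʳ w , ∈-++⁺ʳ w∈ , adj-↑ʳ a

  image∪-dominating : {D₁ D₂ : Subset n} → Dominating C (D₁ ++ D₂) → Dominating G (image f D₁ ∪ D₂)
  image∪-dominating {D₁} {D₂} dom v v∉ with dom (n ↑ʳ v) (v∉ ∘ x∈p∪q⁺ ∘ inj₂ ∘ ∈-++⁻ʳ)
  ... | y , y∈ , a with splitView n n y
  ... | ↑ʳ-view w = w , x∈p∪q⁺ (inj₂ (∈-++⁻ʳ y∈)) , adj-↑ʳ⁻ a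
  ... | ↑ˡ-view u = ⊥-elim (v∉ (x∈p∪q⁺ (inj₁ v∈image)))
    where
    v∈image : v ∈ image f D₁
    v∈image = subst (_∈ image f D₁) (adj-↑ʳ-↑ˡ⁻ a) (∈-image⁺ f (∈-++⁻ˡ {q = D₂} y∈))

proposition2p1 : ∀ {n} (G : Graph n) → Connected G → (f : Fin n → Fin n) →
    (k k′ : ℕ) → IsDominationNumber G k → IsDominationNumber (functigraph G f) k′ →
    k ≤ k′ × k′ ≤ 2 * k
proposition2p1 {n} G _ f _ _ ((D , domD , refl) , minG) ((D′ , domD′ , refl) , minC) =
  lower , upper
  where
  open Functigraph G f
  open ≤-Reasoning

  upper : ∣ D′ ∣ ≤ 2 * ∣ D ∣
  upper = begin
    ∣ D′ ∣          ≤⟨ minC (D ++ D) (++-dominating domD domD) ⟩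
    ∣ D ++ D ∣      ≡⟨ ∣p++q∣≡∣p∣+∣q∣ D D ⟩
    ∣ D ∣ + ∣ D ∣   ≡⟨ cong (∣ D ∣ +_) (+-identityʳ ∣ D ∣) ⟨
    2 * ∣ D ∣       ∎

  lower : ∣ D ∣ ≤ ∣ D′ ∣
  lower with Vec.splitAt n D′
  ... | D₁ , D₂ , refl = begin
    ∣ D ∣               ≤⟨ minG (image f D₁ ∪ D₂) (image∪-dominating domD′) ⟩
    ∣ image f D₁ ∪ D₂ ∣ ≤⟨ ∣image∪q∣≤∣p++q∣ f D₁ D₂ ⟩
    ∣ D₁ ++ D₂ ∣        ∎
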